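{- Let $\Gamma$ be a relator for $T$. Then $\Gamma$-contextual equivalence coincides with the intersection of the $\Gamma$-contextual preorder and its converse: $\equiv_\Gamma=\leq_\Gamma\cap\geq_\Gamma$, where $\geq_\Gamma=(\leq_\Gamma)^c$.
   Context: $T$ is a monad on sets (unit $\eta$, bind $\gg\!=$) such that each $TX$ is an $\omega$CPPO (poset with least element, lubs of $\omega$-chains), bind is continuous in both arguments, and each operation symbol $\sigma$ of a signature $\Sigma$ of arity $k$ is interpreted by a continuous $\sigma^T:(TX)^k\to TX$. Terms/values: $M,N ::= \mathsf{return}\,V\mid VW\mid M\ \mathsf{to}\ x.N\mid\sigma(M_1,\dots,M_k)$, $V,W::=x\mid\lambda x.M$; closed values $\mathcal V_0$. Each closed term $M$ has a semantics $[\![M]\!]\in T\mathcal V_0$ (lub of its finite approximations $M\Downarrow_n X$ given by a standard big-step semantics: $M\Downarrow_0\bot$; $\mathsf{return}\,V\Downarrow_{n+1}\eta(V)$; $M[V/x]\Downarrow_n X\Rightarrow(\lambda x.M)V\Downarrow_{n+1}X$; $M\Downarrow_nX$, $N[V/x]\Downarrow_nY_V\Rightarrow(M\ \mathsf{to}\ x.N)\Downarrow_{n+1}X\gg\!=(V\mapsto Y_V)$; $M_i\Downarrow_nX_i\Rightarrow\sigma(\bar M)\Downarrow_{n+1}\sigma^T(\bar X)$). A relator for $T$ maps $R\subseteq X\times Y$ to $\Gamma R\subseteq TX\times TY$ with $=_{TX}\subseteq\Gamma(=_X)$, $\Gamma S\circ\Gamma R\subseteq\Gamma(S\circ R)$,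 $\Gamma((f\times g)^{ -1}R)=(Tf\times Tg)^{ -1}\Gamma R$, monotonicity, and the lax unit/bind conditions ($x\,R\,y\Rightarrow\eta(x)\,\Gamma R\,\eta(y)$; if $x\,R\,y\Rightarrow f(x)\,\Gamma S\,g(y)$ then $u\,\Gamma R\,v\Rightarrow(u\gg\!=f)\,\Gamma S\,(v\gg\!=g)$). $\Gamma^c(R)=(\Gamma(R^c))^c$ with $^c$ converse; $(\Gamma\cap\Gamma^c)R=\Gamma R\cap\Gamma^cR$. A $\lambda$-term relation is a pair of sets of triples $\bar x\vdash M\,R\,N$ (terms) and $\bar x\vdash V\,R\,W$ (values), free variables in the finite set $\bar x$. It is compatible if: $\bar x\vdash x\,R\,x$ for $x\in\bar x$; $\bar x\cup\{x\}\vdash M\,R\,N\Rightarrow\bar x\vdash\lambda x.M\,R\,\lambda x.N$; $\bar x\vdash V\,R\,W\Rightarrow\bar x\vdash\mathsf{return}\,V\,R\,\mathsf{return}\,W$; $V\,R\,V'$, $W\,R\,W'\Rightarrow VW\,R\,V'W'$; $\bar x\vdash M\,R\,M'$, $\bar x\cup\{x\}\vdash N\,R\,N'\Rightarrow\bar x\vdash M\ \mathsf{to}\ x.N\,R\,M'\ \mathsf{to}\ x.N'$; $M_i\,R\,N_i\ (\forall i)\Rightarrow\sigma(\bar M)\,R\,\sigma(\bar N)$. For a relator $\Delta$, it is $\Delta$-preadequate if $\emptyset\vdash M\,R\,N\Rightarrow[\![M]\!]\,\Delta\mathcal U\,[\![N]\!]$, where $\mathcal U=\mathcal V_0\times\mathcal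 V_0$. $\leq_\Delta$ is the union of all compatible $\Delta$-preadequate relations, and $\equiv_\Gamma=\leq_{\Gamma\cap\Gamma^c}$. -}

module Defs where

open import Data.Nat using (ℕ; zero; suc)
open import Data.Fin using (Fin; zero; suc)
open import Data.Product using (Σ; _×_; _,_; ∃)
open import Data.Unit using (⊤)
open import Relation.Binary.PropositionalEquality using (_≡_)

record Signature : Set₁ where
  field
    Op : Set
    ar : Op → ℕ

record CPPOMonad (Sig : Signature) : Set₁ where
  open Signature Sig
  field
    T    : Set → Set
    η    : ∀ {X : Set} → X → T X
    bind : ∀ {X Y : Set} → T X → (X → T Y) → T Y
    bind-unitˡ : ∀ {X Y : Set} (x : X) (f : X → T Y) → bind (η x) f ≡ f x
    bind-unitʳ : ∀ {X : Set} (u : T X) → bind u η ≡ u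
    bind-assoc : ∀ {X Y Z : Set} (u : T X) (f : X → T Y) (g : Y → T Z) →
                 bind (bind u f) g ≡ bind u (λ x → bind (f x) g)
    _⊑_     : ∀ {X : Set} → T X → T X → Set
    ⊑-refl  : ∀ {X : Set} {u : T X} → u ⊑ u
    ⊑-trans : ∀ {X : Set} {u v w : T X} → u ⊑ v → v ⊑ w → u ⊑ w
    ⊑-antisym : ∀ {X : Set} {u v : T X} → u ⊑ v → v ⊑ u → u ≡ v
    ⊥T      : ∀ {X : Set} → T X
    ⊥T-least : ∀ {X : Set} (u : T X) → ⊥T ⊑ u
    lub       : ∀ {X : Set} (c : ℕ → T X) → (∀ n → c n ⊑ c (suc n)) → T X
    lub-upper : ∀ {X : Set} (c : ℕ → T X) (p : ∀ n → c n ⊑ c (suc n)) (n : ℕ) →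
                c n ⊑ lub c p
    lub-least : ∀ {X : Set} (c : ℕ → T X) (p : ∀ n → c n ⊑ c (suc n)) (u : T X) →
                (∀ n → c n ⊑ u) → lub c p ⊑ u
    bind-mono : ∀ {X Y : Set} {u u' : T X} {f f' : X → T Y} →
                u ⊑ u' → (∀ x → f x ⊑ f' x) → bind u f ⊑ bind u' f'
    bind-contˡ : ∀ {X Y : Set} (c : ℕ → T X) (p : ∀ n → c n ⊑ c (suc n)) (f : X → T Y) →
                 bind (lub c p) f ≡ lub (λ n → bind (c n) f) (λ n → bind-mono (p n) (λ x → ⊑-refl))
    bind-contʳ : ∀ {X Y : Set} (u : T X) (fc : ℕ → X → T Y)
                 (p : ∀ n x → fc n x ⊑ fc (suc n) x) →
                 bind u (λ x → lub (λ n → fc n x) (λ n → p n x))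
                   ≡ lub (λ n → bind u (fc n)) (λ n → bind-mono ⊑-refl (p n))
    opT      : (s : Op) {X : Set} → (Fin (ar s) → T X) → T X
    opT-mono : ∀ (s : Op) {X : Set} {us vs : Fin (ar s) → T X} →
               (∀ i → us i ⊑ vs i) → opT s us ⊑ opT s vs
    opT-cont : ∀ (s : Op) {X : Set} (c : ℕ → Fin (ar s) → T X)
               (p : ∀ n i → c n i ⊑ c (suc n) i) →
               opT s (λ i → lub (λ n → c n i) (λ n → p n i))
                 ≡ lub (λ n → opT s (c n)) (λ n → opT-mono s (p n))

BRel : Set → Set → Set₁
BRel X Y = X → Y → Set

_ᶜ : ∀ {X Y : Set} → BRel X Y → BRel Y X
(R ᶜ) y x = R x y

_⊙_ : ∀ {X Y Z : Set} → BRel Y Z → BRel X Y → BRel X Z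
(S ⊙ R) x z = ∃ λ y → R x y × S y z

preimg : ∀ {X Y X' Y' : Set} → (X → X') → (Y → Y') → BRel X' Y' → BRel X Y
preimg f g R x y = R (f x) (g y)

RelTrans : (Set → Set) → Set₁
RelTrans T = ∀ {X Y : Set} → BRel X Y → BRel (T X) (T Y)

conv : ∀ {T : Set → Set} → RelTrans T → RelTrans T
conv Γ R = (Γ (R ᶜ)) ᶜ

_∩R_ : ∀ {T : Set → Set} → RelTrans T → RelTrans T → RelTrans T
(Γ ∩R Δ) R u v = Γ R u v × Δ R u v

record Relator {Sig : Signature} (𝕋 : CPPOMonad Sig) : Set₁ where
  open CPPOMonad 𝕋
  fmap : ∀ {X Y : Set} → (X → Y) → T X → T Y
  fmap f u = bind u (λ x → η (f x))
  field
    Γ : RelTrans T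
    Γ-refl  : ∀ {X : Set} (u : T X) → Γ _≡_ u u
    Γ-comp  : ∀ {X Y Z : Set} {R : BRel X Y} {S : BRel Y Z} {u v w} →
              Γ R u v → Γ S v w → Γ (S ⊙ R) u w
    Γ-preimg₁ : ∀ {X Y X' Y' : Set} (f : X → X') (g : Y → Y') (R : BRel X' Y') u v →
                Γ (preimg f g R) u v → Γ R (fmap f u) (fmap g v)
    Γ-preimg₂ : ∀ {X Y X' Y' : Set} (f : X → X') (g : Y → Y') (R : BRel X' Y') u v →
                Γ R (fmap f u) (fmap g v) → Γ (preimg f g R) u v
    Γ-mono  : ∀ {X Y : Set} {R S : BRel X Y} → (∀ x y → R x y → S x y) →
              ∀ u v → Γ R u v → Γ S u v
    Γ-unit  : ∀ {X Y : Set} {R : BRel X Y} x y → R x y → Γ R (η x) (η y)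
    Γ-bind  : ∀ {X Y X' Y' : Set} {R : BRel X Y} {S : BRel X' Y'}
              {f : X → T X'} {g : Y → T Y'} →
              (∀ x y → R x y → Γ S (f x) (g y)) →
              ∀ u v → Γ R u v → Γ S (bind u f) (bind v g)

-- The λ-calculus (well-scoped de Bruijn syntax; a context is the number
-- of free variables)

module Lang (Sig : Signature) where
  open Signature Sig

  data Val (n : ℕ) : Set
  data Tm (n : ℕ) : Set

  data Val n where
    var : Fin n → Val n
    lam : Tm (suc n) → Val n

  data Tm n where
    ret  : Val n → Tm n
    app  : Val n → Val n → Tm n
    _to_ : Tm n → Tm (suc n) → Tm n
    op   : (s : Op) → (Fin (ar s) → Tm n) → Tm n

  ext : ∀ {n m} → (Fin n → Fin m) → Fin (suc n) → Fin (suc m)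
  ext ρ zero = zero
  ext ρ (suc i) = suc (ρ i)

  renV : ∀ {n m} → (Fin n → Fin m) → Val n → Val m
  renT : ∀ {n m} → (Fin n → Fin m) → Tm n → Tm m
  renV ρ (var i) = var (ρ i)
  renV ρ (lam M) = lam (renT (ext ρ) M)
  renT ρ (ret V) = ret (renV ρ V)
  renT ρ (app V W) = app (renV ρ V) (renV ρ W)
  renT ρ (M to N) = renT ρ M to renT (ext ρ) N
  renT ρ (op s Ms) = op s (λ i → renT ρ (Ms i))

  exts : ∀ {n m} → (Fin n → Val m) → Fin (suc n) → Val (suc m)
  exts σ zero = var zero
  exts σ (suc i) = renV suc (σ i)

  subV : ∀ {n m} → (Fin n → Val m) → Val n → Val m
  subT : ∀ {n m} → (Fin n → Val m) → Tm n → Tm m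
  subV σ (var i) = σ i
  subV σ (lam M) = lam (subT (exts σ) M)
  subT σ (ret V) = ret (subV σ V)
  subT σ (app V W) = app (subV σ V) (subV σ W)
  subT σ (M to N) = subT σ M to subT (exts σ) N
  subT σ (op s Ms) = op s (λ i → subT σ (Ms i))

  single : ∀ {n} → Val n → Fin (suc n) → Val n
  single V zero = V
  single V (suc i) = var i

  -- M[V/x], x the most recently bound variable
  _[_] : ∀ {n} → Tm (suc n) → Val n → Tm n
  M [ V ] = subT (single V) M

  record TermRel : Set₁ where
    field
      tm : ∀ n → Tm n → Tm n → Set
      vl : ∀ n → Val n → Val n → Set

  record Compatible (R : TermRel) : Set where
    open TermRel R
    field
      c-var : ∀ n (i : Fin n) → vl n (var i) (var i)
      c-lam : ∀ n M N → tm (suc n) M N → vl n (lam M) (lam N)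
      c-ret : ∀ n V W → vl n V W → tm n (ret V) (ret W)
      c-app : ∀ n V V' W W' → vl n V V' → vl n W W' → tm n (app V W) (app V' W')
      c-to  : ∀ n M M' N N' → tm n M M' → tm (suc n) N N' → tm n (M to N) (M' to N')
      c-op  : ∀ n (s : Op) (Ms Ns : Fin (ar s) → Tm n) →
              (∀ i → tm n (Ms i) (Ns i)) → tm n (op s Ms) (op s Ns)

module Semantics {Sig : Signature} (𝕋 : CPPOMonad Sig) where
  open Signature Sig
  open CPPOMonad 𝕋
  open Lang Sig public

  -- finite approximations: approx n M is the unique X with M ⇓ₙ X
  approx : ℕ → Tm 0 → T (Val 0)
  approx zero M = ⊥T
  approx (suc n) (ret V) = η V
  approx (suc n) (app (var ()) W)
  approx (suc n) (app (lam M) W) = approx n (M [ W ])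
  approx (suc n) (M to N) = bind (approx n M) (λ V → approx n (N [ V ]))
  approx (suc n) (op s Ms) = opT s (λ i → approx n (Ms i))

  approx-chain : ∀ n M → approx n M ⊑ approx (suc n) M
  approx-chain zero M = ⊥T-least _
  approx-chain (suc n) (ret V) = ⊑-refl
  approx-chain (suc n) (app (var ()) W)
  approx-chain (suc n) (app (lam M) W) = approx-chain n (M [ W ])
  approx-chain (suc n) (M to N) =
    bind-mono (approx-chain n M) (λ V → approx-chain n (N [ V ]))
  approx-chain (suc n) (op s Ms) = opT-mono s (λ i → approx-chain n (Ms i))

  ⟦_⟧ : Tm 0 → T (Val 0)
  ⟦ M ⟧ = lub (λ n → approx n M) (λ n → approx-chain n M)

  𝒰 : BRel (Val 0) (Val 0)
  𝒰 _ _ = ⊤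

  PreAdequate : RelTrans T → TermRel → Set
  PreAdequate Δ R = ∀ M N → TermRel.tm R 0 M N → Δ 𝒰 ⟦ M ⟧ ⟦ N ⟧

  ctxPreTm : RelTrans T → ∀ n → Tm n → Tm n → Set₁
  ctxPreTm Δ n M N = Σ TermRel λ R → Compatible R × PreAdequate Δ R × TermRel.tm R n M N

  ctxPreVl : RelTrans T → ∀ n → Val n → Val n → Set₁
  ctxPreVl Δ n V W = Σ TermRel λ R → Compatible R × PreAdequate Δ R × TermRel.vl R n V W

  ctxEqTm : RelTrans T → ∀ n → Tm n → Tm n → Set₁
  ctxEqTm Γ = ctxPreTm (Γ ∩R conv Γ)

  ctxEqVl : RelTrans T → ∀ n → Val n → Val n → Set₁
  ctxEqVl Γ = ctxPreVl (Γ ∩R conv Γ)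

module Submission where

-- By definition ≡_Γ = ≤_{Γ ∩ Γᶜ}, so the theorem follows from two facts that
-- hold for arbitrary relation transformers Γ, Δ (no relator axiom is used):
--
--   (1) ≤_{Γ ∩ Δ} = ≤_Γ ∩ ≤_Δ     (2) ≤_{Γᶜ} = (≤_Γ)ᶜ.
--
-- Both are proved by transporting witnesses.  A witness for ≤_Δ is a compatible,
-- Δ-preadequate λ-term relation, and the operations needed on witnesses are the
-- pointwise intersection of two λ-term relations and the converse of one.
--
-- Fact (2) uses that the total relation 𝒰 on closed values is symmetric: 𝒰ᶜ and
-- 𝒰 are definitionally equal, so Γᶜ 𝒰 u v is literally Γ 𝒰 v u.

open import Defs
open import Data.Nat using (ℕ)
open import Data.Product using (_×_; _,_; proj₁; proj₂)
open import Function.Bundles using (_⇔_; mk⇔)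
open import Function.Construct.Identity using (⇔-id)
open import Function.Construct.Composition using (_⇔-∘_)
open import Data.Product.Function.NonDependent.Propositional using (_×-⇔_)

module TermRelations (Sig : Signature) where
  open Lang Sig
  open TermRel
  open Compatible

  _ᶜᵀ : TermRel → TermRel
  tm (R ᶜᵀ) n M N = tm R n N M
  vl (R ᶜᵀ) n V W = vl R n W V

  _∩ᵀ_ : TermRel → TermRel → TermRel
  tm (R ∩ᵀ S) n M N = tm R n M N × tm S n M N
  vl (R ∩ᵀ S) n V W = vl R n V W × vl S n V W

  -- Every compatibility rule is symmetric in its two sides, so converses of
  -- compatible relations are compatible.
  compatible-ᶜ : ∀ {R} → Compatible R → Compatible (R ᶜᵀ)
  c-var (compatible-ᶜ c) = c-var c
  c-lam (compatible-ᶜ c) n M N = c-lam c n N M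
  c-ret (compatible-ᶜ c) n V W = c-ret c n W V
  c-app (compatible-ᶜ c) n V V' W W' = c-app c n V' V W' W
  c-to  (compatible-ᶜ c) n M M' N N' = c-to c n M' M N' N
  c-op  (compatible-ᶜ c) n s Ms Ns = c-op c n s Ns Ms

  -- Compatibility rules are Horn clauses, hence closed under intersection.
  compatible-∩ : ∀ {R S} → Compatible R → Compatible S → Compatible (R ∩ᵀ S)
  c-var (compatible-∩ c d) n i = c-var c n i , c-var d n i
  c-lam (compatible-∩ c d) n M N (p , q) = c-lam c n M N p , c-lam d n M N q
  c-ret (compatible-∩ c d) n V W (p , q) = c-ret c n V W p , c-ret d n V W q
  c-app (compatible-∩ c d) n V V' W W' (p , q) (p' , q') =
    c-app c n V V' W W' p p' , c-app d n V V' W W' q q'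
  c-to (compatible-∩ c d) n M M' N N' (p , q) (p' , q') =
    c-to c n M M' N N' p p' , c-to d n M M' N N' q q'
  c-op (compatible-∩ c d) n s Ms Ns h =
    c-op c n s Ms Ns (λ i → proj₁ (h i)) , c-op d n s Ms Ns (λ i → proj₂ (h i))

module Contextual {Sig : Signature} (𝕋 : CPPOMonad Sig) where
  open CPPOMonad 𝕋 using (T)
  open Semantics 𝕋
  open TermRelations Sig

  preadequate-∩ : ∀ (Γ Δ : RelTrans T) (R S : TermRel) →
                  PreAdequate Γ R → PreAdequate Δ S → PreAdequate (Γ ∩R Δ) (R ∩ᵀ S)
  preadequate-∩ Γ Δ R S p q M N (r , s) = p M N r , q M N s

  preadequate-∩ˡ : ∀ (Γ Δ : RelTrans T) (R : TermRel) →
                   PreAdequate (Γ ∩R Δ) R → PreAdequate Γ R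
  preadequate-∩ˡ Γ Δ R p M N r = proj₁ (p M N r)

  preadequate-∩ʳ : ∀ (Γ Δ : RelTrans T) (R : TermRel) →
                   PreAdequate (Γ ∩R Δ) R → PreAdequate Δ R
  preadequate-∩ʳ Γ Δ R p M N r = proj₂ (p M N r)

  -- Taking the converse of both the relation and the transformer preserves
  -- preadequacy; this is where the symmetry of 𝒰 is used.
  preadequate-ᶜ : ∀ (Γ : RelTrans T) (R : TermRel) →
                  PreAdequate Γ R → PreAdequate (conv Γ) (R ᶜᵀ)
  preadequate-ᶜ Γ R p M N r = p N M r

  preadequate-ᶜ⁻ : ∀ (Γ : RelTrans T) (R : TermRel) →
                   PreAdequate (conv Γ) R → PreAdequate Γ (R ᶜᵀ)
  preadequate-ᶜ⁻ Γ R p M N r = p N M r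

  ctxPreTm-∩ : ∀ (Γ Δ : RelTrans T) n (M N : Tm n) →
               ctxPreTm (Γ ∩R Δ) n M N ⇔ (ctxPreTm Γ n M N × ctxPreTm Δ n M N)
  ctxPreTm-∩ Γ Δ n M N = mk⇔
    (λ (R , c , p , r) →
      (R , c , preadequate-∩ˡ Γ Δ R p , r) , (R , c , preadequate-∩ʳ Γ Δ R p , r))
    (λ ((R , c , p , r) , (S , d , q , s)) →
      R ∩ᵀ S , compatible-∩ c d , preadequate-∩ Γ Δ R S p q , (r , s))

  ctxPreVl-∩ : ∀ (Γ Δ : RelTrans T) n (V W : Val n) →
               ctxPreVl (Γ ∩R Δ) n V W ⇔ (ctxPreVl Γ n V W × ctxPreVl Δ n V W)
  ctxPreVl-∩ Γ Δ n V W = mk⇔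
    (λ (R , c , p , r) →
      (R , c , preadequate-∩ˡ Γ Δ R p , r) , (R , c , preadequate-∩ʳ Γ Δ R p , r))
    (λ ((R , c , p , r) , (S , d , q , s)) →
      R ∩ᵀ S , compatible-∩ c d , preadequate-∩ Γ Δ R S p q , (r , s))

  ctxPreTm-ᶜ : ∀ (Γ : RelTrans T) n (M N : Tm n) →
               ctxPreTm (conv Γ) n M N ⇔ ctxPreTm Γ n N M
  ctxPreTm-ᶜ Γ n M N = mk⇔
    (λ (R , c , p , r) → R ᶜᵀ , compatible-ᶜ c , preadequate-ᶜ⁻ Γ R p , r)
    (λ (R , c , p , r) → R ᶜᵀ , compatible-ᶜ c , preadequate-ᶜ Γ R p , r)

  ctxPreVl-ᶜ : ∀ (Γ : RelTrans T) n (V W : Val n) →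
               ctxPreVl (conv Γ) n V W ⇔ ctxPreVl Γ n W V
  ctxPreVl-ᶜ Γ n V W = mk⇔
    (λ (R , c , p , r) → R ᶜᵀ , compatible-ᶜ c , preadequate-ᶜ⁻ Γ R p , r)
    (λ (R , c , p , r) → R ᶜᵀ , compatible-ᶜ c , preadequate-ᶜ Γ R p , r)

mainTheorem5 : ∀ {Sig : Signature} (𝕋 : CPPOMonad Sig) (Γ : Relator 𝕋) →
    (∀ (n : ℕ) (M N : Lang.Tm Sig n) →
      Semantics.ctxEqTm 𝕋 (Relator.Γ Γ) n M N
        ⇔ (Semantics.ctxPreTm 𝕋 (Relator.Γ Γ) n M N × Semantics.ctxPreTm 𝕋 (Relator.Γ Γ) n N M))
    × (∀ (n : ℕ) (V W : Lang.Val Sig n) →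
      Semantics.ctxEqVl 𝕋 (Relator.Γ Γ) n V W
        ⇔ (Semantics.ctxPreVl 𝕋 (Relator.Γ Γ) n V W × Semantics.ctxPreVl 𝕋 (Relator.Γ Γ) n W V))
mainTheorem5 𝕋 G = onTerms , onValues
  where
  open Semantics 𝕋
  open Contextual 𝕋
  Γ : RelTrans (CPPOMonad.T 𝕋)
  Γ = Relator.Γ G
  -- ≡_Γ = ≤_{Γ ∩ Γᶜ} = ≤_Γ ∩ ≤_{Γᶜ} = ≤_Γ ∩ ≥_Γ
  onTerms : ∀ n (M N : Tm n) →
            ctxEqTm Γ n M N ⇔ (ctxPreTm Γ n M N × ctxPreTm Γ n N M)
  onTerms n M N = (⇔-id _ ×-⇔ ctxPreTm-ᶜ Γ n M N) ⇔-∘ ctxPreTm-∩ Γ (conv Γ) n M N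
  onValues : ∀ n (V W : Val n) →
             ctxEqVl Γ n V W ⇔ (ctxPreVl Γ n V W × ctxPreVl Γ n W V)
  onValues n V W = (⇔-id _ ×-⇔ ctxPreVl-ᶜ Γ n V W) ⇔-∘ ctxPreVl-∩ Γ (conv Γ) n V W
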